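{- For every integer $m>0$ and every integer $n\ge 0$, $$\sum_{k=0}^{n}\binom{n}{k}\frac{(m+2k)\,(m+k-1)!}{(n+m+k)!}=\frac{2^n}{(m+1)(m+3)\cdots(m+2n-1)}.$$
   Context: For $n=0$ the empty product in the denominator equals $1$. -}

module Defs where

open import Data.Nat using (ℕ; zero; suc; _+_; _*_; _∸_; _^_; NonZero)
open import Data.Nat.Properties using (_!≢0; m*n≢0)
open import Data.Nat.Combinatorics using (_C_)
open import Data.Nat.Base using (_!)
open import Data.Integer using (+_)
open import Data.Rational using (ℚ; _/_) renaming (_+_ to _+ℚ_)

sumTo : ℕ → (ℕ → ℚ) → ℚ
sumTo zero f = f 0
sumTo (suc n) f = sumTo n f +ℚ f (suc n)

-- (m+1)(m+3)⋯(m+2n-1) = ∏_{i=0}^{n-1} (m + 2i + 1); empty product = 1 for n = 0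
oddProd : ℕ → ℕ → ℕ
oddProd m zero = 1
oddProd m (suc n) = oddProd m n * suc (m + 2 * n)

oddProd≢0 : ∀ m n → NonZero (oddProd m n)
oddProd≢0 m zero = _
oddProd≢0 m (suc n) = m*n≢0 (oddProd m n) (suc (m + 2 * n)) {{oddProd≢0 m n}}

summand : ℕ → ℕ → ℕ → ℚ
summand m n k = (+ ((n C k) * (m + 2 * k) * ((m + k ∸ 1) !))) / ((n + m + k) !)
  where instance _ = (n + m + k) !≢0

rhs : ℕ → ℕ → ℚ
rhs m n = (+ (2 ^ n)) / oddProd m n
  where instance _ = oddProd≢0 m n

-- Write T_n(k) for the k-th summand and S_n = Σ_{k ≤ n} T_n(k). Both S_n and the right-hand
-- side x_n satisfy (m+2n+1)·x_{n+1} = 2·x_n, and they agree at n = 0. For S_n this recurrence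
-- telescopes: with H_n(0) = 0 and H_n(k) = C(n,k-1)(m+2k-1)(m+k-1)!/(n+m+k)! for k ≥ 1,
--   (m+2n+1)·T_{n+1}(k) + H_n(k+1) = 2·T_n(k) + H_n(k),
-- and summing over k ≤ n+1 the boundary terms H_n(0) and H_n(n+2) vanish. After clearing
-- denominators the termwise identity is polynomial, up to Pascal's rule and the absorption
-- identity k·C(n+1,k) = (n+1)·C(n,k-1).
module Submission where

open import Defs
open import Data.Nat using (ℕ; _<_)
open import Relation.Binary.PropositionalEquality using (_≡_)

open import Algebra using (CommutativeMonoid)
open import Data.Integer using (+_)
import Data.Integer as ℤ
import Data.Integer.Properties as ℤ
open import Data.List using (_∷_; [])
open import Data.Nat using (zero; suc; NonZero; _+_; _*_; _!; _^_)
import Data.Nat.Properties as ℕ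
open import Data.Nat.Combinatorics using (_C_; nC1≡n; nCk+nC[k+1]≡[n+1]C[k+1]; k>n⇒nCk≡0)
open import Data.Nat.Tactic.RingSolver using (solve-∀; solve)
open import Data.Rational using (ℚ; _/_; fromℚᵘ; toℚᵘ; 0ℚ; 1ℚ)
  renaming (_+_ to _+ℚ_; _*_ to _*ℚ_)
open import Data.Rational.Properties
  using ( toℚᵘ-injective; toℚᵘ-fromℚᵘ; toℚᵘ-homo-+; toℚᵘ-homo-*; fromℚᵘ-cong; /-cong; 0/n≡0
        ; +-assoc; +-identityʳ; +-0-commutativeMonoid; *-assoc; *-comm; *-identityˡ; *-zeroʳ
        ; *-distribˡ-+ )
open import Data.Rational.Unnormalised as ℚᵘ using (mkℚᵘ; *≡*)
import Data.Rational.Unnormalised.Properties as ℚᵘ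
open import Relation.Binary.PropositionalEquality
  using (refl; sym; trans; cong; cong₂; module ≡-Reasoning)
open import Algebra.Properties.CommutativeSemigroup
  (CommutativeMonoid.commutativeSemigroup +-0-commutativeMonoid)
  using (x∙yz≈xz∙y; xy∙z≈xz∙y)

fromℚᵘ-homo-+ : ∀ p q → fromℚᵘ (p ℚᵘ.+ q) ≡ fromℚᵘ p +ℚ fromℚᵘ q
fromℚᵘ-homo-+ p q = toℚᵘ-injective (begin
  toℚᵘ (fromℚᵘ (p ℚᵘ.+ q))               ≈⟨ toℚᵘ-fromℚᵘ (p ℚᵘ.+ q) ⟩
  p ℚᵘ.+ q                               ≈⟨ ℚᵘ.+-cong (toℚᵘ-fromℚᵘ p) (toℚᵘ-fromℚᵘ q) ⟨
  toℚᵘ (fromℚᵘ p) ℚᵘ.+ toℚᵘ (fromℚᵘ q)  ≈⟨ toℚᵘ-homo-+ (fromℚᵘ p) (fromℚᵘ q) ⟨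
  toℚᵘ (fromℚᵘ p +ℚ fromℚᵘ q)            ∎)
  where open ℚᵘ.≃-Reasoning

fromℚᵘ-homo-* : ∀ p q → fromℚᵘ (p ℚᵘ.* q) ≡ fromℚᵘ p *ℚ fromℚᵘ q
fromℚᵘ-homo-* p q = toℚᵘ-injective (begin
  toℚᵘ (fromℚᵘ (p ℚᵘ.* q))               ≈⟨ toℚᵘ-fromℚᵘ (p ℚᵘ.* q) ⟩
  p ℚᵘ.* q                               ≈⟨ ℚᵘ.*-cong (toℚᵘ-fromℚᵘ p) (toℚᵘ-fromℚᵘ q) ⟨
  toℚᵘ (fromℚᵘ p) ℚᵘ.* toℚᵘ (fromℚᵘ q)  ≈⟨ toℚᵘ-homo-* (fromℚᵘ p) (fromℚᵘ q) ⟨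
  toℚᵘ (fromℚᵘ p *ℚ fromℚᵘ q)            ∎)
  where open ℚᵘ.≃-Reasoning

a*e≡b*d⇒a/d≡b/e : ∀ {a b d e} .{{_ : NonZero d}} .{{_ : NonZero e}} →
                  a * e ≡ b * d → + a / d ≡ + b / e
a*e≡b*d⇒a/d≡b/e {a} {b} {suc d} {suc e} eq = fromℚᵘ-cong {mkℚᵘ (+ a) d} {mkℚᵘ (+ b) e}
  (*≡* (trans (sym (ℤ.pos-* a (suc e))) (trans (cong +_ eq) (ℤ.pos-* b (suc d)))))

a/d+b/d≡[a+b]/d : ∀ a b d .{{_ : NonZero d}} → + a / d +ℚ + b / d ≡ + (a + b) / d
a/d+b/d≡[a+b]/d a b (suc d) = begin
  + a / suc d +ℚ + b / suc d                    ≡⟨ fromℚᵘ-homo-+ (mkℚᵘ (+ a) d) (mkℚᵘ (+ b) d) ⟨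
  fromℚᵘ (mkℚᵘ (+ a) d ℚᵘ.+ mkℚᵘ (+ b) d)       ≡⟨ /-cong numerator refl ⟩
  + (a * suc d + b * suc d) / (suc d * suc d)   ≡⟨ a*e≡b*d⇒a/d≡b/e {a * suc d + b * suc d} {a + b}
                                                     (solve (a ∷ b ∷ d ∷ [])) ⟩
  + (a + b) / suc d                             ∎
  where
  open ≡-Reasoning
  numerator : + a ℤ.* + suc d ℤ.+ + b ℤ.* + suc d ≡ + (a * suc d + b * suc d)
  numerator = sym (trans (ℤ.pos-+ (a * suc d) (b * suc d))
                         (cong₂ ℤ._+_ (ℤ.pos-* a (suc d)) (ℤ.pos-* b (suc d))))

c/1*a/d≡[c*a]/d : ∀ c a d .{{_ : NonZero d}} → + c / 1 *ℚ (+ a / d) ≡ + (c * a) / d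
c/1*a/d≡[c*a]/d c a (suc d) = begin
  + c / 1 *ℚ (+ a / suc d)                 ≡⟨ fromℚᵘ-homo-* (mkℚᵘ (+ c) 0) (mkℚᵘ (+ a) d) ⟨
  fromℚᵘ (mkℚᵘ (+ c) 0 ℚᵘ.* mkℚᵘ (+ a) d)  ≡⟨ /-cong (sym (ℤ.pos-* c a)) (ℕ.*-identityˡ (suc d)) ⟩
  + (c * a) / suc d                        ∎
  where open ≡-Reasoning

c/1*p≡c/1*q⇒p≡q : ∀ c .{{_ : NonZero c}} {p q} → + c / 1 *ℚ p ≡ + c / 1 *ℚ q → p ≡ q
c/1*p≡c/1*q⇒p≡q c {p} {q} eq = begin
  p                              ≡⟨ *-identityˡ p ⟨
  1ℚ *ℚ p                        ≡⟨ cong (_*ℚ p) inverse ⟨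
  + 1 / c *ℚ (+ c / 1) *ℚ p      ≡⟨ *-assoc (+ 1 / c) (+ c / 1) p ⟩
  + 1 / c *ℚ (+ c / 1 *ℚ p)      ≡⟨ cong (+ 1 / c *ℚ_) eq ⟩
  + 1 / c *ℚ (+ c / 1 *ℚ q)      ≡⟨ *-assoc (+ 1 / c) (+ c / 1) q ⟨
  + 1 / c *ℚ (+ c / 1) *ℚ q      ≡⟨ cong (_*ℚ q) inverse ⟩
  1ℚ *ℚ q                        ≡⟨ *-identityˡ q ⟩
  q                              ∎
  where
  open ≡-Reasoning
  inverse : + 1 / c *ℚ (+ c / 1) ≡ 1ℚ
  inverse = trans (*-comm (+ 1 / c) (+ c / 1))
                  (trans (c/1*a/d≡[c*a]/d c 1 c) (a*e≡b*d⇒a/d≡b/e {c * 1} {1} {c} {1} (solve (c ∷ []))))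

a≡0⇒a/d≡0 : ∀ {a} d .{{_ : NonZero d}} → a ≡ 0 → + a / d ≡ 0ℚ
a≡0⇒a/d≡0 d refl = 0/n≡0 d

sumTo-*ˡ : ∀ c f n → sumTo n (λ k → c *ℚ f k) ≡ c *ℚ sumTo n f
sumTo-*ˡ c f zero    = refl
sumTo-*ˡ c f (suc n) = trans (cong (_+ℚ c *ℚ f (suc n)) (sumTo-*ˡ c f n))
                             (sym (*-distribˡ-+ c (sumTo n f) (f (suc n))))

sumTo-telescope : ∀ {f g h : ℕ → ℚ} → (∀ k → f k +ℚ h (suc k) ≡ g k +ℚ h k) →
                  ∀ n → sumTo n f +ℚ h (suc n) ≡ sumTo n g +ℚ h 0
sumTo-telescope step zero = step 0
sumTo-telescope {f} {g} {h} step (suc n) = begin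
  sumTo n f +ℚ f (suc n) +ℚ h (suc (suc n))    ≡⟨ +-assoc (sumTo n f) (f (suc n)) (h (suc (suc n))) ⟩
  sumTo n f +ℚ (f (suc n) +ℚ h (suc (suc n)))  ≡⟨ cong (λ x → sumTo n f +ℚ x) (step (suc n)) ⟩
  sumTo n f +ℚ (g (suc n) +ℚ h (suc n))        ≡⟨ x∙yz≈xz∙y (sumTo n f) (g (suc n)) (h (suc n)) ⟩
  sumTo n f +ℚ h (suc n) +ℚ g (suc n)          ≡⟨ cong (_+ℚ g (suc n)) (sumTo-telescope step n) ⟩
  sumTo n g +ℚ h 0 +ℚ g (suc n)                ≡⟨ xy∙z≈xz∙y (sumTo n g) (h 0) (g (suc n)) ⟩
  sumTo n g +ℚ g (suc n) +ℚ h 0                ∎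
  where open ≡-Reasoning

sumTo-telescope-vanishing : ∀ {f g h : ℕ → ℚ} n → h 0 ≡ 0ℚ → h (suc n) ≡ 0ℚ →
                            (∀ k → f k +ℚ h (suc k) ≡ g k +ℚ h k) → sumTo n f ≡ sumTo n g
sumTo-telescope-vanishing {f} {g} {h} n h₀≡0 hₙ₊₁≡0 step = begin
  sumTo n f                  ≡⟨ +-identityʳ (sumTo n f) ⟨
  sumTo n f +ℚ 0ℚ            ≡⟨ cong (λ x → sumTo n f +ℚ x) hₙ₊₁≡0 ⟨
  sumTo n f +ℚ h (suc n)     ≡⟨ sumTo-telescope step n ⟩
  sumTo n g +ℚ h 0           ≡⟨ cong (λ x → sumTo n g +ℚ x) h₀≡0 ⟩
  sumTo n g +ℚ 0ℚ            ≡⟨ +-identityʳ (sumTo n g) ⟩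
  sumTo n g                  ∎
  where open ≡-Reasoning

[k+1]*[n+1]C[k+1]≡[n+1]*nCk : ∀ n k → suc k * (suc n C suc k) ≡ suc n * (n C k)
[k+1]*[n+1]C[k+1]≡[n+1]*nCk zero    zero    = refl
[k+1]*[n+1]C[k+1]≡[n+1]*nCk zero    (suc k) = ℕ.*-zeroʳ (suc (suc k))
[k+1]*[n+1]C[k+1]≡[n+1]*nCk (suc n) zero    =
  trans (ℕ.+-identityʳ _) (trans (nC1≡n (suc (suc n))) (sym (ℕ.*-identityʳ _)))
[k+1]*[n+1]C[k+1]≡[n+1]*nCk (suc n) (suc k) = begin
  suc (suc k) * (suc (suc n) C suc (suc k))
    ≡⟨ cong (suc (suc k) *_) (nCk+nC[k+1]≡[n+1]C[k+1] (suc n) (suc k)) ⟨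
  suc (suc k) * (X + Y)
    ≡⟨ regroup k X Y ⟩
  X + (suc k * X + suc (suc k) * Y)
    ≡⟨ cong₂ (λ u v → X + (u + v)) ([k+1]*[n+1]C[k+1]≡[n+1]*nCk n k)
                                     ([k+1]*[n+1]C[k+1]≡[n+1]*nCk n (suc k)) ⟩
  X + (suc n * (n C k) + suc n * (n C suc k))
    ≡⟨ cong (λ x → X + x) (ℕ.*-distribˡ-+ (suc n) (n C k) (n C suc k)) ⟨
  X + suc n * (n C k + n C suc k)
    ≡⟨ cong (λ x → X + suc n * x) (nCk+nC[k+1]≡[n+1]C[k+1] n k) ⟩
  suc (suc n) * X
    ∎
  where
  open ≡-Reasoning
  X = suc n C suc k
  Y = suc n C suc (suc k)
  regroup : ∀ k x y → suc (suc k) * (x + y) ≡ x + (suc k * x + suc (suc k) * y)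
  regroup = solve-∀

-- Here m = p+1, k = j+1, a = C(n,k), b = C(n,k-1) and F = (m+k-1)!.
telescoping-polynomial : ∀ n p j a b F → suc j * (b + a) ≡ suc n * b →
  suc (suc p + 2 * n) * ((b + a) * (suc p + 2 * suc j) * F)
    + a * (suc p + 2 * suc j + 1) * (suc (p + suc j) * F)
  ≡ (2 * (a * (suc p + 2 * suc j) * F) + b * (suc p + 2 * j + 1) * F) * suc (n + suc p + suc j)
telescoping-polynomial n p j a b F absorption =
  ℕ.+-cancelʳ-≡ (excess (suc j * (b + a))) _ _
    (trans (expand n p j a b F) (cong (λ x → right + excess x) (sym absorption)))
  where
  right : ℕ
  right = (2 * (a * (suc p + 2 * suc j) * F) + b * (suc p + 2 * j + 1) * F) * suc (n + suc p + suc j)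
  excess : ℕ → ℕ
  excess x = (suc p + 2 * suc j + 1) * F * x
  -- Not a polynomial identity by itself: it becomes one after adding excess (k·(b+a)) on the
  -- left and excess ((n+1)·b) on the right, and the hypothesis says these are equal.
  expand : ∀ n p j a b F →
    suc (suc p + 2 * n) * ((b + a) * (suc p + 2 * suc j) * F)
      + a * (suc p + 2 * suc j + 1) * (suc (p + suc j) * F)
      + (suc p + 2 * suc j + 1) * F * (suc j * (b + a))
    ≡ (2 * (a * (suc p + 2 * suc j) * F) + b * (suc p + 2 * j + 1) * F) * suc (n + suc p + suc j)
      + (suc p + 2 * suc j + 1) * F * (suc n * b)
  expand = solve-∀

rhs-step : ∀ m n → + suc (m + 2 * n) / 1 *ℚ rhs m (suc n) ≡ + 2 / 1 *ℚ rhs m n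
rhs-step m n = begin
  + c / 1 *ℚ rhs m (suc n)     ≡⟨ c/1*a/d≡[c*a]/d c (2 ^ suc n) (oddProd m (suc n)) ⟩
  + (c * 2 ^ suc n) / (P * c)  ≡⟨ a*e≡b*d⇒a/d≡b/e {c * 2 ^ suc n} {2 ^ suc n} (regroup c (2 ^ n) P) ⟩
  + (2 ^ suc n) / P            ≡⟨ c/1*a/d≡[c*a]/d 2 (2 ^ n) P ⟨
  + 2 / 1 *ℚ rhs m n           ∎
  where
  open ≡-Reasoning
  c = suc (m + 2 * n)
  P = oddProd m n
  instance
    _ = oddProd≢0 m n
    _ = oddProd≢0 m (suc n)
  regroup : ∀ c x P → c * (2 * x) * P ≡ 2 * x * (P * c)
  regroup = solve-∀

module _ (p : ℕ) where

  private
    m : ℕ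
    m = suc p

  summandNumerator : ℕ → ℕ → ℕ
  summandNumerator n k = (n C k) * (m + 2 * k) * ((p + k) !)

  correctionNumerator : ℕ → ℕ → ℕ
  correctionNumerator n zero    = 0
  correctionNumerator n (suc j) = (n C j) * (m + 2 * j + 1) * ((m + j) !)

  correction : ℕ → ℕ → ℚ
  correction n k = + correctionNumerator n k / (n + m + k) !
    where instance _ = (n + m + k) ℕ.!≢0

  numerator-step : ∀ n k →
    suc (m + 2 * n) * summandNumerator (suc n) k + correctionNumerator n (suc k)
      ≡ (2 * summandNumerator n k + correctionNumerator n k) * suc (n + m + k)
  numerator-step n zero    = initial n p ((p + 0) !)
    where
    initial : ∀ n p F →
      suc (suc p + 2 * n) * (1 * (suc p + 2 * 0) * F) + 1 * (suc p + 2 * 0 + 1) * (suc (p + 0) * F)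
      ≡ (2 * (1 * (suc p + 2 * 0) * F) + 0) * suc (n + suc p + 0)
    initial = solve-∀
  numerator-step n (suc j) = begin
    c * ((suc n C suc j) * M * F) + a * (M + 1) * ((m + suc j) !)
      ≡⟨ cong (λ x → c * (x * M * F) + a * (M + 1) * ((m + suc j) !)) pascal ⟨
    c * ((b + a) * M * F) + a * (M + 1) * ((m + suc j) !)
      ≡⟨ telescoping-polynomial n p j a b F absorption ⟩
    (2 * (a * M * F) + b * (m + 2 * j + 1) * F) * s
      ≡⟨ cong (λ x → (2 * (a * M * F) + b * (m + 2 * j + 1) * x) * s) (cong _! (ℕ.+-suc p j)) ⟩
    (2 * (a * M * F) + b * (m + 2 * j + 1) * ((m + j) !)) * s
      ∎
    where
    open ≡-Reasoning
    a = n C suc j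
    b = n C j
    c = suc (m + 2 * n)
    s = suc (n + m + suc j)
    M = m + 2 * suc j
    F = (p + suc j) !
    pascal : b + a ≡ suc n C suc j
    pascal = nCk+nC[k+1]≡[n+1]C[k+1] n j
    absorption : suc j * (b + a) ≡ suc n * b
    absorption = trans (cong (suc j *_) pascal) ([k+1]*[n+1]C[k+1]≡[n+1]*nCk n j)

  summand-step : ∀ n k →
    + suc (m + 2 * n) / 1 *ℚ summand m (suc n) k +ℚ correction n (suc k)
      ≡ + 2 / 1 *ℚ summand m n k +ℚ correction n k
  summand-step n k = begin
    + c / 1 *ℚ summand m (suc n) k +ℚ correction n (suc k)
      ≡⟨ cong₂ _+ℚ_ (c/1*a/d≡[c*a]/d c (summandNumerator (suc n) k) W)
                    (/-cong {+ correctionNumerator n (suc k)} refl (cong _! (ℕ.+-suc (n + m) k))) ⟩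
    + (c * summandNumerator (suc n) k) / W +ℚ + correctionNumerator n (suc k) / W
      ≡⟨ a/d+b/d≡[a+b]/d (c * summandNumerator (suc n) k) (correctionNumerator n (suc k)) W ⟩
    + (c * summandNumerator (suc n) k + correctionNumerator n (suc k)) / W
      ≡⟨ /-cong (cong +_ (numerator-step n k)) refl ⟩
    + (N * s) / (s * D)
      ≡⟨ a*e≡b*d⇒a/d≡b/e {N * s} {N} (ℕ.*-assoc N s D) ⟩
    + N / D
      ≡⟨ a/d+b/d≡[a+b]/d (2 * summandNumerator n k) (correctionNumerator n k) D ⟨
    + (2 * summandNumerator n k) / D +ℚ correction n k
      ≡⟨ cong (_+ℚ correction n k) (c/1*a/d≡[c*a]/d 2 (summandNumerator n k) D) ⟨
    + 2 / 1 *ℚ summand m n k +ℚ correction n k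
      ∎
    where
    open ≡-Reasoning
    c = suc (m + 2 * n)
    s = suc (n + m + k)
    D = (n + m + k) !
    W = s !
    N = 2 * summandNumerator n k + correctionNumerator n k
    instance
      _ = (n + m + k) ℕ.!≢0
      _ = s ℕ.!≢0
      _ = (n + m + suc k) ℕ.!≢0

  summand-vanishes : ∀ n → summand m n (suc n) ≡ 0ℚ
  summand-vanishes n = a≡0⇒a/d≡0 ((n + m + suc n) !)
    (cong (λ x → x * (m + 2 * suc n) * ((p + suc n) !)) (k>n⇒nCk≡0 (ℕ.n<1+n n)))
    where instance _ = (n + m + suc n) ℕ.!≢0

  correction-vanishes : ∀ n → correction n (suc (suc n)) ≡ 0ℚ
  correction-vanishes n = a≡0⇒a/d≡0 ((n + m + suc (suc n)) !)
    (cong (λ x → x * (m + 2 * suc n + 1) * ((m + suc n) !)) (k>n⇒nCk≡0 (ℕ.n<1+n n)))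
    where instance _ = (n + m + suc (suc n)) ℕ.!≢0

  sum-step : ∀ n → + suc (m + 2 * n) / 1 *ℚ sumTo (suc n) (summand m (suc n))
                 ≡ + 2 / 1 *ℚ sumTo n (summand m n)
  sum-step n = begin
    + c / 1 *ℚ sumTo (suc n) (summand m (suc n))
      ≡⟨ sumTo-*ˡ (+ c / 1) (summand m (suc n)) (suc n) ⟨
    sumTo (suc n) (λ k → + c / 1 *ℚ summand m (suc n) k)
      ≡⟨ sumTo-telescope-vanishing (suc n) (a≡0⇒a/d≡0 ((n + m + 0) !) refl)
                                   (correction-vanishes n) (summand-step n) ⟩
    sumTo n g +ℚ + 2 / 1 *ℚ summand m n (suc n)
      ≡⟨ cong (λ x → sumTo n g +ℚ + 2 / 1 *ℚ x) (summand-vanishes n) ⟩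
    sumTo n g +ℚ + 2 / 1 *ℚ 0ℚ
      ≡⟨ cong (λ x → sumTo n g +ℚ x) (*-zeroʳ (+ 2 / 1)) ⟩
    sumTo n g +ℚ 0ℚ
      ≡⟨ +-identityʳ (sumTo n g) ⟩
    sumTo n g
      ≡⟨ sumTo-*ˡ (+ 2 / 1) (summand m n) n ⟩
    + 2 / 1 *ℚ sumTo n (summand m n)
      ∎
    where
    open ≡-Reasoning
    c = suc (m + 2 * n)
    g : ℕ → ℚ
    g k = + 2 / 1 *ℚ summand m n k
    instance _ = (n + m + 0) ℕ.!≢0

  sum-base : sumTo 0 (summand m 0) ≡ rhs m 0
  sum-base = a*e≡b*d⇒a/d≡b/e {summandNumerator 0 0} {1} (initial p ((p + 0) !))
    where
    instance _ = (0 + m + 0) ℕ.!≢0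
    initial : ∀ p F → 1 * (suc p + 2 * 0) * F * 1 ≡ 1 * (suc (p + 0) * F)
    initial = solve-∀

mainTheorem4 : (m n : ℕ) → 0 < m → sumTo n (summand m n) ≡ rhs m n
mainTheorem4 (suc p) zero    _   = sum-base p
mainTheorem4 (suc p) (suc n) 0<m = c/1*p≡c/1*q⇒p≡q c (begin
  + c / 1 *ℚ sumTo (suc n) (summand m (suc n))   ≡⟨ sum-step p n ⟩
  + 2 / 1 *ℚ sumTo n (summand m n)               ≡⟨ cong (+ 2 / 1 *ℚ_) (mainTheorem4 m n 0<m) ⟩
  + 2 / 1 *ℚ rhs m n                             ≡⟨ rhs-step m n ⟨
  + c / 1 *ℚ rhs m (suc n)                       ∎)
  where
  open ≡-Reasoning
  m = suc p
  c = suc (m + 2 * n)
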